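{- For all nonnegative integers $n$, $a$, $\Delta$ such that $n \geq 2\Delta$ and $\Delta \leq a \leq n - \Delta$, \[ F(n,a,\Delta) \geq \binom{n-2\Delta}{a-\Delta}. \]
   Context: For a finite graph $G$, a permutation of the vertices of $G$ is a sequence listing every vertex of $G$ exactly once; two such permutations $\pi,\sigma$ are $G$-different if there is an index $i$ such that $\{\pi(i),\sigma(i)\}$ is an edge of $G$; $F(G)$ denotes the maximum size of a family of pairwise $G$-different permutations of the vertices of $G$. For a subgraph $G$ of $K_{a,n-a}$ on the same $n$ vertices (with the same bipartition), the bipartite complement of $G$ is the graph on the same vertices whose edges are the edges of $K_{a,n-a}$ not in $G$. $F(n,a,\Delta)$ denotes the minimum of $F(G)$ over all $n$-vertex bipartite graphs $G$ that are subgraphs of $K_{a,n-a}$ and whose bipartite complement has maximum degree $\Delta$. -}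

module Defs where

open import Data.Nat using (ℕ; _+_; _⊔_; _∸_)
open import Data.Bool using (Bool; true; false; if_then_else_)
open import Data.Fin using (Fin)
open import Data.List using (List; map; foldr; _++_; allFin)
open import Data.Nat.ListAction using (sum)
open import Data.Sum using (_⊎_; inj₁; inj₂)
open import Data.Product using (∃-syntax; Σ)
open import Data.Empty using (⊥)
open import Data.Unit using (⊤)
open import Function.Bundles using (_↔_; Inverse)
open import Relation.Binary.PropositionalEquality using (_≡_)
open import Relation.Nullary using (¬_)

Vertex : ℕ → ℕ → Set
Vertex a b = Fin a ⊎ Fin b

-- A bipartite graph G ⊆ K_{a,b} (same vertex set and bipartition):
-- G x y = true iff {x,y} (x ∈ A, y ∈ B) is an edge of G.
BipGraph : ℕ → ℕ → Set
BipGraph a b = Fin a → Fin b → Bool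

Adj : ∀ {a b} → BipGraph a b → Vertex a b → Vertex a b → Set
Adj G (inj₁ x) (inj₂ y) = G x y ≡ true
Adj G (inj₂ y) (inj₁ x) = G x y ≡ true
Adj G (inj₁ _) (inj₁ _) = ⊥
Adj G (inj₂ _) (inj₂ _) = ⊥

bipComplement : ∀ {a b} → BipGraph a b → BipGraph a b
bipComplement G x y = if G x y then false else true

-- Degrees and maximum degree of a bipartite graph (max over the empty set is 0).
degA : ∀ {a b} → BipGraph a b → Fin a → ℕ
degA {b = b} H x = sum (map (λ y → if H x y then 1 else 0) (allFin b))

degB : ∀ {a b} → BipGraph a b → Fin b → ℕ
degB {a = a} H y = sum (map (λ x → if H x y then 1 else 0) (allFin a))

maxDegree : ∀ {a b} → BipGraph a b → ℕ
maxDegree {a} {b} H = foldr _⊔_ 0 (map (degA H) (allFin a) ++ map (degB H) (allFin b))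

-- A permutation of the vertices: a sequence (indexed by positions Fin (a+b))
-- listing every vertex exactly once, i.e. a bijection positions ↔ vertices.
VertexPerm : ℕ → ℕ → Set
VertexPerm a b = Fin (a + b) ↔ Vertex a b

GDifferent : ∀ {a b} → BipGraph a b → VertexPerm a b → VertexPerm a b → Set
GDifferent G π σ = ∃[ i ] Adj G (Inverse.to π i) (Inverse.to σ i)

-- F(G) ≥ k : there is a family of k pairwise G-different permutations.
FAtLeast : ∀ {a b} → BipGraph a b → ℕ → Set
FAtLeast {a} {b} G k =
  Σ (Fin k → VertexPerm a b) λ fam →
    (i j : Fin k) → ¬ (i ≡ j) → GDifferent G (fam i) (fam j)

module Submission where

-- Write A, B for the two sides (|A| = a, |B| = b) and suppose every vertex has
-- at most Δ non-neighbours in G.  We show by induction on (a, b) that G admits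
-- a family of  bound Δ a b = C((a∸Δ) + (b∸Δ), a∸Δ)  pairwise G-different
-- orderings.  If a ≤ Δ or b ≤ Δ the bound is 1 and any single ordering works.
-- Otherwise a fixed x ∈ A has fewer than |B| non-neighbours, hence a neighbour
-- y ∈ B.  Deleting x (resp. y) keeps the co-degree bound, so induction gives
-- families for G - x and G - y; putting x (resp. y) in front of every ordering
-- yields families for G, and orderings from different families are
-- G-different at the first position because {x, y} is an edge.  Pascal's rule
-- adds up the two counts.  The theorem is the case b = n - a.

open import Defs
open import Data.Nat using (ℕ; _≤_; _*_; _∸_)
open import Data.Nat.Combinatorics using (_C_)
open import Relation.Binary.PropositionalEquality using (_≡_)

open import Data.Nat using (zero; suc; _+_; _<_; _⊔_; _≤?_; s≤s; s≤s⁻¹)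
open import Data.Nat.Properties
open import Data.Nat.Combinatorics using (nCn≡1; nCk+nC[k+1]≡[n+1]C[k+1])
open import Data.Nat.ListAction using (sum)
open import Data.Bool using (Bool; true; false; if_then_else_)
open import Data.Fin as F using (Fin; punchIn; splitAt)
open import Data.Fin.Properties using (+↔⊎)
open import Data.Fin.Permutation using (insert)
open import Data.List using (List; _∷_; map; foldr; _++_; allFin; tabulate)
open import Data.List.Properties using (map-tabulate)
open import Data.List.Membership.Propositional using (_∈_)
open import Data.List.Membership.Propositional.Properties using (∈-++⁺ˡ; ∈-++⁺ʳ; ∈-map⁺; ∈-allFin)
open import Data.List.Relation.Unary.Any using (here; there)
open import Data.Sum using (_⊎_; inj₁; inj₂)
open import Data.Sum.Algebra using (⊎-assoc; ⊎-comm)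
open import Data.Sum.Function.Propositional using (_⊎-↔_)
open import Data.Product using (∃-syntax; Σ; _,_; _×_)
open import Data.Empty using (⊥-elim)
open import Function using (_∘_)
open import Function.Bundles using (_↔_; Inverse; Injection)
open import Function.Properties.Inverse using (↔-refl; ↔-sym; ↔-trans; ↔⇒↣)
open import Level using (0ℓ)
open import Relation.Binary.PropositionalEquality using (refl; sym; trans; cong; subst; _≢_; module ≡-Reasoning)
open import Relation.Nullary using (yes; no)

open Inverse using (to)

indicator : Bool → ℕ
indicator b = if b then 1 else 0

count : ∀ {n} → (Fin n → Bool) → ℕ
count {zero}  p = 0
count {suc n} p = indicator (p F.zero) + count (p ∘ F.suc)

sum-indicator : ∀ {n} (p : Fin n → Bool) → sum (map (indicator ∘ p) (allFin n)) ≡ count p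
sum-indicator {n} p = trans (cong sum (map-tabulate (λ i → i) (indicator ∘ p))) (sum-tabulate p)
  where
  sum-tabulate : ∀ {m} (q : Fin m → Bool) → sum (tabulate (indicator ∘ q)) ≡ count q
  sum-tabulate {zero}  q = refl
  sum-tabulate {suc m} q = cong (indicator (q _) +_) (sum-tabulate (q ∘ F.suc))

count<⇒false : ∀ {n} (p : Fin n → Bool) → count p < n → ∃[ i ] p i ≡ false
count<⇒false {suc n} p lt with p F.zero in eq
... | false = F.zero , eq
... | true with count<⇒false (p ∘ F.suc) (s≤s⁻¹ lt)
...   | i , pi≡false = F.suc i , pi≡false

count-punchIn : ∀ {n} (p : Fin (suc n) → Bool) (i : Fin (suc n)) → count (p ∘ punchIn i) ≤ count p
count-punchIn         p F.zero    = m≤n+m _ _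
count-punchIn {suc n} p (F.suc i) = +-monoʳ-≤ (indicator (p _)) (count-punchIn (p ∘ F.suc) i)

≤-foldr-⊔ : ∀ {x : ℕ} {xs : List ℕ} → x ∈ xs → x ≤ foldr _⊔_ 0 xs
≤-foldr-⊔ {xs = y ∷ xs} (here refl) = m≤m⊔n y _
≤-foldr-⊔ {xs = y ∷ xs} (there p)   = ≤-trans (≤-foldr-⊔ p) (m≤n⊔m y _)

CoDegree≤ : ∀ {a b} → ℕ → BipGraph a b → Set
CoDegree≤ Δ G = (∀ x → count (λ y → bipComplement G x y) ≤ Δ)
              × (∀ y → count (λ x → bipComplement G x y) ≤ Δ)

codegree-maxDegree : ∀ {a b} (G : BipGraph a b) → CoDegree≤ (maxDegree (bipComplement G)) G
codegree-maxDegree {a} {b} G =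
    (λ x → bounded (sum-indicator (H x)) (∈-++⁺ˡ (∈-map⁺ (degA H) (∈-allFin x))))
  , (λ y → bounded (sum-indicator (λ x → H x y)) (∈-++⁺ʳ (map (degA H) (allFin a)) (∈-map⁺ (degB H) (∈-allFin y))))
  where
  H = bipComplement G
  bounded : ∀ {d c} → d ≡ c → d ∈ map (degA H) (allFin a) ++ map (degB H) (allFin b) → c ≤ maxDegree H
  bounded refl d∈ = ≤-foldr-⊔ d∈

neighbour : ∀ {a b Δ} (G : BipGraph a (suc b)) → CoDegree≤ Δ G → Δ ≤ b → ∀ x → ∃[ y ] G x y ≡ true
neighbour G (rows , _) Δ≤b x with count<⇒false (bipComplement G x) (s≤s (≤-trans (rows x) Δ≤b))
... | y , non-edge = y , complement-false (G x y) non-edge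
  where
  complement-false : ∀ e → (if e then false else true) ≡ false → e ≡ true
  complement-false true _ = refl

deleteA : ∀ {a b} → Fin (suc a) → BipGraph (suc a) b → BipGraph a b
deleteA x G u y = G (punchIn x u) y

deleteB : ∀ {a b} → Fin (suc b) → BipGraph a (suc b) → BipGraph a b
deleteB y G x v = G x (punchIn y v)

codegree-deleteA : ∀ {a b Δ} x (G : BipGraph (suc a) b) → CoDegree≤ Δ G → CoDegree≤ Δ (deleteA x G)
codegree-deleteA x G (rows , cols) =
  (λ u → rows (punchIn x u)) , (λ y → ≤-trans (count-punchIn (λ u → bipComplement G u y) x) (cols y))

codegree-deleteB : ∀ {a b Δ} y (G : BipGraph a (suc b)) → CoDegree≤ Δ G → CoDegree≤ Δ (deleteB y G)
codegree-deleteB y G (rows , cols) =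
  (λ x → ≤-trans (count-punchIn (bipComplement G x) y) (rows x)) , (λ v → cols (punchIn y v))

-- Families of orderings of an arbitrary vertex type V under a relation R;
-- for R = Adj G these are exactly the families counted by FAtLeast G.
module Orderings {V : Set} (R : V → V → Set) where

  Separated : ∀ {N} → Fin N ↔ V → Fin N ↔ V → Set
  Separated π σ = ∃[ p ] R (to π p) (to σ p)

  Distinguishing : ℕ → ℕ → Set
  Distinguishing N k = Σ (Fin k → Fin N ↔ V) λ fam → ∀ i j → i ≢ j → Separated (fam i) (fam j)

  single : ∀ {N} → Fin N ↔ V → Distinguishing N 1
  single π = (λ _ → π) , λ { F.zero F.zero 0≢0 → ⊥-elim (0≢0 refl) }

  union : ∀ {N k₁ k₂} ((fam₁ , sep₁) : Distinguishing N k₁) ((fam₂ , sep₂) : Distinguishing N k₂) →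
          (∀ i j → Separated (fam₁ i) (fam₂ j)) → (∀ i j → Separated (fam₂ j) (fam₁ i)) →
          Distinguishing N (k₁ + k₂)
  union {N} {k₁} {k₂} (fam₁ , sep₁) (fam₂ , sep₂) cross₁₂ cross₂₁ =
    fam ∘ splitAt k₁ , λ i j i≢j → sep (splitAt k₁ i) (splitAt k₁ j) (i≢j ∘ splitAt-injective)
    where
    splitAt-injective : ∀ {i j} → splitAt k₁ i ≡ splitAt k₁ j → i ≡ j
    splitAt-injective = Injection.injective (↔⇒↣ (+↔⊎ {k₁} {k₂}))
    fam : Fin k₁ ⊎ Fin k₂ → Fin N ↔ V
    fam (inj₁ i) = fam₁ i
    fam (inj₂ j) = fam₂ j
    sep : ∀ s t → s ≢ t → Separated (fam s) (fam t)
    sep (inj₁ i) (inj₁ j) s≢t = sep₁ i j (s≢t ∘ cong inj₁)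
    sep (inj₂ i) (inj₂ j) s≢t = sep₂ i j (s≢t ∘ cong inj₂)
    sep (inj₁ i) (inj₂ j) _   = cross₁₂ i j
    sep (inj₂ j) (inj₁ i) _   = cross₂₁ i j

open Orderings using (Distinguishing)

-- An ordering of X becomes one of V by putting the vertex e(inj₁ 0) first,
-- given a bijection e between V and X plus one extra point.
prepend : ∀ {N} {X V : Set} → (Fin 1 ⊎ X) ↔ V → Fin N ↔ X → Fin (suc N) ↔ V
prepend e π = ↔-trans (+↔⊎ {1}) (↔-trans (↔-refl ⊎-↔ π) e)

prepend-family : ∀ {N k} {X V : Set} (R′ : X → X → Set) (R : V → V → Set) (e : (Fin 1 ⊎ X) ↔ V) →
                 (∀ {s t} → R′ s t → R (to e (inj₂ s)) (to e (inj₂ t))) →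
                 Distinguishing R′ N k → Distinguishing R (suc N) k
prepend-family R′ R e lift (fam , sep) = prepend e ∘ fam , λ i j i≢j → separated (sep i j i≢j)
  where
  separated : ∀ {i j} → Orderings.Separated R′ (fam i) (fam j) → Orderings.Separated R (prepend e (fam i)) (prepend e (fam j))
  separated (p , r) = F.suc p , lift r

-- Fin (suc n) as the point x together with the other points punchIn x u.
pointed : ∀ {n} → Fin (suc n) → (Fin 1 ⊎ Fin n) ↔ Fin (suc n)
pointed {n} x = ↔-trans (↔-sym (+↔⊎ {1} {n})) (insert F.zero x ↔-refl)

-- The vertices of K_{a+1,b} as x ∈ A together with those of K_{a,b}, and similarly for y ∈ B.
removeA : ∀ {a b} → Fin (suc a) → (Fin 1 ⊎ Vertex a b) ↔ Vertex (suc a) b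
removeA x = ↔-trans (↔-sym (⊎-assoc 0ℓ _ _ _)) (pointed x ⊎-↔ ↔-refl)

removeB : ∀ {a b} → Fin (suc b) → (Fin 1 ⊎ Vertex a b) ↔ Vertex a (suc b)
removeB y = ↔-trans (↔-sym (⊎-assoc 0ℓ _ _ _))
           (↔-trans (⊎-comm _ _ ⊎-↔ ↔-refl) (↔-trans (⊎-assoc 0ℓ _ _ _) (↔-refl ⊎-↔ pointed y)))

adj-deleteA : ∀ {a b} x (G : BipGraph (suc a) b) {s t} →
              Adj (deleteA x G) s t → Adj G (to (removeA x) (inj₂ s)) (to (removeA x) (inj₂ t))
adj-deleteA x G {inj₁ _} {inj₂ _} e = e
adj-deleteA x G {inj₂ _} {inj₁ _} e = e

adj-deleteB : ∀ {a b} y (G : BipGraph a (suc b)) {s t} →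
              Adj (deleteB y G) s t → Adj G (to (removeB y) (inj₂ s)) (to (removeB y) (inj₂ t))
adj-deleteB y G {inj₁ _} {inj₂ _} e = e
adj-deleteB y G {inj₂ _} {inj₁ _} e = e

branch : ∀ {a b N k₁ k₂} (G : BipGraph (suc a) (suc b)) x y → G x y ≡ true →
         Distinguishing (Adj (deleteA x G)) N k₁ → Distinguishing (Adj (deleteB y G)) N k₂ →
         Distinguishing (Adj G) (suc N) (k₁ + k₂)
branch G x y xy D₁ D₂ =
  Orderings.union (Adj G) (prepend-family (Adj (deleteA x G)) (Adj G) (removeA x) (adj-deleteA x G) D₁)
                          (prepend-family (Adj (deleteB y G)) (Adj G) (removeB y) (adj-deleteB y G) D₂)
                          (λ _ _ → F.zero , xy) (λ _ _ → F.zero , xy)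

bound : ℕ → ℕ → ℕ → ℕ
bound Δ a b = ((a ∸ Δ) + (b ∸ Δ)) C (a ∸ Δ)

bound-trivial : ∀ Δ a b → a ∸ Δ ≡ 0 ⊎ b ∸ Δ ≡ 0 → bound Δ a b ≡ 1
bound-trivial Δ a b (inj₁ a∸Δ≡0) rewrite a∸Δ≡0 = refl
bound-trivial Δ a b (inj₂ b∸Δ≡0) rewrite b∸Δ≡0 | +-identityʳ (a ∸ Δ) = nCn≡1 (a ∸ Δ)

bound-pascal : ∀ {Δ a b} → Δ ≤ a → Δ ≤ b → bound Δ (suc a) (suc b) ≡ bound Δ a (suc b) + bound Δ (suc a) b
bound-pascal {Δ} {a} {b} Δ≤a Δ≤b
  rewrite +-∸-assoc 1 Δ≤a | +-∸-assoc 1 Δ≤b = begin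
    suc (A + suc B) C suc A                    ≡⟨ nCk+nC[k+1]≡[n+1]C[k+1] (A + suc B) A ⟨
    (A + suc B) C A + (A + suc B) C suc A       ≡⟨ cong (λ m → (A + suc B) C A + m C suc A) (+-suc A B) ⟩
    (A + suc B) C A + suc (A + B) C suc A       ∎
  where
  open ≡-Reasoning
  A = a ∸ Δ
  B = b ∸ Δ

∸-+-∸ : ∀ {Δ a b} → Δ ≤ a → Δ ≤ b → (a ∸ Δ) + (b ∸ Δ) ≡ (a + b) ∸ 2 * Δ
∸-+-∸ {Δ} {a} {b} Δ≤a Δ≤b = begin
  (a ∸ Δ) + (b ∸ Δ)    ≡⟨ +-∸-assoc (a ∸ Δ) Δ≤b ⟨
  (a ∸ Δ) + b ∸ Δ      ≡⟨ cong (_∸ Δ) (+-∸-comm b Δ≤a) ⟨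
  (a + b) ∸ Δ ∸ Δ      ≡⟨ ∸-+-assoc (a + b) Δ Δ ⟩
  (a + b) ∸ (Δ + Δ)    ≡⟨ cong ((a + b) ∸_) (cong (Δ +_) (+-identityʳ Δ)) ⟨
  (a + b) ∸ 2 * Δ      ∎
  where open ≡-Reasoning

trivial : ∀ Δ {a b N} → N ≡ a + b → (G : BipGraph a b) → a ∸ Δ ≡ 0 ⊎ b ∸ Δ ≡ 0 →
          Distinguishing (Adj G) N (bound Δ a b)
trivial Δ {a} {b} refl G small =
  subst (Distinguishing (Adj G) (a + b)) (sym (bound-trivial Δ a b small)) (Orderings.single (Adj G) +↔⊎)

-- The number of positions N is kept apart from a + b because deleting a vertex of B
-- changes a + suc b into a + b only up to +-suc.
distinguishing-family : ∀ Δ {a b N} → N ≡ a + b → (G : BipGraph a b) → CoDegree≤ Δ G → Distinguishing (Adj G) N (bound Δ a b)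
distinguishing-family Δ {zero}          N≡ G cd = trivial Δ N≡ G (inj₁ (0∸n≡0 Δ))
distinguishing-family Δ {suc a} {zero}  N≡ G cd = trivial Δ N≡ G (inj₂ (0∸n≡0 Δ))
distinguishing-family Δ {suc a} {suc b} {zero} ()
distinguishing-family Δ {suc a} {suc b} {suc N} N≡ G cd with Δ ≤? a | Δ ≤? b
... | no Δ≰a | _      = trivial Δ N≡ G (inj₁ (m≤n⇒m∸n≡0 (≰⇒> Δ≰a)))
... | yes _  | no Δ≰b = trivial Δ N≡ G (inj₂ (m≤n⇒m∸n≡0 (≰⇒> Δ≰b)))
... | yes Δ≤a | yes Δ≤b with neighbour G cd Δ≤b F.zero
...   | y , xy = subst (Distinguishing (Adj G) (suc N)) (sym (bound-pascal Δ≤a Δ≤b))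
  (branch G F.zero y xy
    (distinguishing-family Δ (suc-injective N≡) (deleteA F.zero G) (codegree-deleteA F.zero G cd))
    (distinguishing-family Δ (trans (suc-injective N≡) (+-suc a b)) (deleteB y G) (codegree-deleteB y G cd)))

theorem2 : (n a Δ : ℕ) → 2 * Δ ≤ n → Δ ≤ a → a ≤ n ∸ Δ →
    (G : BipGraph a (n ∸ a)) → maxDegree (bipComplement G) ≡ Δ →
    FAtLeast G ((n ∸ 2 * Δ) C (a ∸ Δ))
theorem2 n a Δ 2Δ≤n Δ≤a a≤n∸Δ G maxDeg≡Δ =
  subst (FAtLeast G) bound≡
    (distinguishing-family Δ refl G (subst (λ d → CoDegree≤ d G) maxDeg≡Δ (codegree-maxDegree G)))
  where
  a≤n : a ≤ n
  a≤n = ≤-trans a≤n∸Δ (m∸n≤m n Δ)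
  -- Δ + a ≤ n, since Δ ≤ 2Δ ≤ n and a ≤ n ∸ Δ.
  Δ≤n∸a : Δ ≤ n ∸ a
  Δ≤n∸a = m+n≤o⇒m≤o∸n Δ (subst (_≤ n) (+-comm a Δ) (m≤o∸n⇒m+n≤o a (≤-trans (m≤m+n Δ (Δ + 0)) 2Δ≤n) a≤n∸Δ))
  bound≡ : bound Δ a (n ∸ a) ≡ (n ∸ 2 * Δ) C (a ∸ Δ)
  bound≡ = cong (_C (a ∸ Δ)) (trans (∸-+-∸ Δ≤a Δ≤n∸a) (cong (_∸ 2 * Δ) (m+[n∸m]≡n a≤n)))
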